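{- Let $R$ be a finite commutative ring with unity and $\Gamma'(R)$ its cozero-divisor graph. Let $X_1,\dots,X_k$ be the equivalence classes of the relation $\equiv$ on $V(\Gamma'(R))$ given by $x\equiv y\iff (x)=(y)$. Then: (i) for each $i\in\{1,\dots,k\}$, the subgraph of $\Gamma'(R)$ induced by $X_i$ is isomorphic to the edgeless graph $\overline{K}_{|X_i|}$; (ii) for distinct $i,j\in\{1,\dots,k\}$, a vertex of $X_i$ is adjacent either to all or to none of the vertices of $X_j$.
   Context: The cozero-divisor graph $\Gamma'(R)$ of a ring $R$ with unity is the simple undirected graph whose vertices are the non-zero non-unit elements of $R$, with distinct vertices $x,y$ adjacent iff $x\notin Ry$ and $y\notin Rx$. $(x)$ denotes the principal ideal generated by $x$. -}

module Defs where

open import Level using (Level; _⊔_)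
open import Algebra.Bundles using (CommutativeRing)
open import Data.Nat using (ℕ)
open import Data.Fin using (Fin)
open import Data.Product using (Σ; ∃; _×_)
open import Relation.Nullary using (¬_)
import Relation.Binary.PropositionalEquality as P
open import Function.Bundles using (Inverse)

module _ {c ℓ : Level} (R : CommutativeRing c ℓ) where
  open CommutativeRing R

  Finite : Set (c ⊔ ℓ)
  Finite = ∃ λ (n : ℕ) → Inverse setoid (P.setoid (Fin n))

  IsUnit : Carrier → Set (c ⊔ ℓ)
  IsUnit u = ∃ λ v → u * v ≈ 1#

  _∈R_ : Carrier → Carrier → Set (c ⊔ ℓ)
  x ∈R y = ∃ λ r → x ≈ r * y

  IsVertex : Carrier → Set (c ⊔ ℓ)
  IsVertex x = (¬ x ≈ 0#) × (¬ IsUnit x)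

  Vertex : Set (c ⊔ ℓ)
  Vertex = Σ Carrier IsVertex

  elt : Vertex → Carrier
  elt = Data.Product.proj₁

  Adj : Vertex → Vertex → Set (c ⊔ ℓ)
  Adj x y = (¬ elt x ≈ elt y) × (¬ (elt x ∈R elt y)) × (¬ (elt y ∈R elt x))

  -- x ≡ y  iff  (x) = (y)  (equality of principal ideals = mutual containment)
  SameIdeal : Vertex → Vertex → Set (c ⊔ ℓ)
  SameIdeal x y = (elt x ∈R elt y) × (elt y ∈R elt x)

-- Write x ≼ y for x ∈ Ry. This is a preorder, and ≡ is its associated equivalence.
-- Two vertices of one class contain each other, so they are never adjacent. For a
-- vertex x and a class Y with representative y, adjacency of x to z ∈ Y only asks
-- that x and z be ≼-incomparable, which depends on y alone; and x, z incomparable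
-- already forces x ≠ z. Finiteness is used only to decide ≼, so that x is either
-- comparable or incomparable to y.
module Submission where

open import Defs
open import Level using (Level; _⊔_)
open import Algebra.Bundles using (CommutativeRing)
open import Data.Product using (_×_; _,_; ∃; proj₂)
open import Data.Sum using (_⊎_; inj₁; inj₂)
open import Data.Fin.Properties using (_≟_; any?)
open import Function.Bundles using (Inverse)
open import Function.Properties.Inverse using (Inverse⇒Injection)
open import Relation.Nullary using (¬_; Dec; yes; no; _⊎-dec_)
open import Relation.Nullary.Decidable using (via-injection)
open import Relation.Unary using (Pred)
open import Relation.Binary.Definitions using (Decidable)

module _ {c ℓ : Level} (R : CommutativeRing c ℓ) where
  open CommutativeRing R
  open import Algebra.Definitions.RawMagma *-rawMagma using (_∣ʳ_) renaming (_,_ to _∣ʳ-by_)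
  open import Algebra.Properties.Monoid.Divisibility *-monoid using (∣ʳ-trans; ∣ʳ-reflexive)

  ∈R⇒∣ʳ : ∀ {x y} → _∈R_ R x y → y ∣ʳ x
  ∈R⇒∣ʳ (r , x≈ry) = r ∣ʳ-by sym x≈ry

  ∣ʳ⇒∈R : ∀ {x y} → y ∣ʳ x → _∈R_ R x y
  ∣ʳ⇒∈R (r ∣ʳ-by ry≈x) = r , sym ry≈x

  ∈R-trans : ∀ {x y z} → _∈R_ R x y → _∈R_ R y z → _∈R_ R x z
  ∈R-trans x∈Ry y∈Rz = ∣ʳ⇒∈R (∣ʳ-trans (∈R⇒∣ʳ y∈Rz) (∈R⇒∣ʳ x∈Ry))

  ≈⇒∈R : ∀ {x y} → x ≈ y → _∈R_ R x y
  ≈⇒∈R x≈y = ∣ʳ⇒∈R (∣ʳ-reflexive (sym x≈y))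

  SameIdeal⇒¬Adj : (x y : Vertex R) → SameIdeal R x y → ¬ Adj R x y
  SameIdeal⇒¬Adj x y (x∈Ry , _) (_ , x∉Ry , _) = x∉Ry x∈Ry

  Comparable : Vertex R → Vertex R → Set (c ⊔ ℓ)
  Comparable x y = _∈R_ R (elt R x) (elt R y) ⊎ _∈R_ R (elt R y) (elt R x)

  comparable⇒¬Adj : ∀ x y z → Comparable x y → SameIdeal R z y → ¬ Adj R x z
  comparable⇒¬Adj _ _ _ (inj₁ x∈Ry) (_ , y∈Rz) (_ , x∉Rz , _) = x∉Rz (∈R-trans x∈Ry y∈Rz)
  comparable⇒¬Adj _ _ _ (inj₂ y∈Rx) (z∈Ry , _) (_ , _ , z∉Rx) = z∉Rx (∈R-trans z∈Ry y∈Rx)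

  incomparable⇒Adj : ∀ x y z → ¬ Comparable x y → SameIdeal R z y → Adj R x z
  incomparable⇒Adj _ _ _ x⋈y (z∈Ry , y∈Rz) =
      (λ x≈z → x⋈y (inj₁ (∈R-trans (≈⇒∈R x≈z) z∈Ry)))
    , (λ x∈Rz → x⋈y (inj₁ (∈R-trans x∈Rz z∈Ry)))
    , (λ z∈Rx → x⋈y (inj₂ (∈R-trans y∈Rz z∈Rx)))

  Adj-all-or-none : Decidable (_∈R_ R) → (x y : Vertex R) →
    ((z : Vertex R) → SameIdeal R z y → Adj R x z)
    ⊎ ((z : Vertex R) → SameIdeal R z y → ¬ Adj R x z)
  Adj-all-or-none _∈R?_ x y with (elt R x ∈R? elt R y) ⊎-dec (elt R y ∈R? elt R x)
  ... | yes x∼y = inj₂ λ z → comparable⇒¬Adj x y z x∼y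
  ... | no x⋈y  = inj₁ λ z → incomparable⇒Adj x y z x⋈y

  module _ (finite : Finite R) where
    open Inverse (proj₂ finite)

    Finite⇒≈? : Decidable _≈_
    Finite⇒≈? = via-injection (Inverse⇒Injection (proj₂ finite)) _≟_

    Finite⇒∃? : ∀ {p} {P : Pred Carrier p} → (∀ {a b} → a ≈ b → P a → P b) →
                (∀ a → Dec (P a)) → Dec (∃ P)
    Finite⇒∃? resp P? with any? (λ i → P? (from i))
    ... | yes (i , Pi) = yes (from i , Pi)
    ... | no ¬∃P       = no λ (a , Pa) → ¬∃P (to a , resp (sym (strictlyInverseʳ a)) Pa)

    Finite⇒∈R? : Decidable (_∈R_ R)
    Finite⇒∈R? a b = Finite⇒∃? (λ r≈s a≈rb → trans a≈rb (*-cong r≈s refl))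
                               (λ r → Finite⇒≈? a (r * b))

corollary2p2 : {c ℓ : Level} (R : CommutativeRing c ℓ) → Finite R →
    ((x y : Vertex R) → SameIdeal R x y → ¬ Adj R x y)
    × ((x y : Vertex R) → ¬ SameIdeal R x y →
        ((z : Vertex R) → SameIdeal R z y → Adj R x z)
        ⊎ ((z : Vertex R) → SameIdeal R z y → ¬ Adj R x z))
corollary2p2 R finite =
  SameIdeal⇒¬Adj R , λ x y _ → Adj-all-or-none R (Finite⇒∈R? R finite) x y
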